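{- Let $n\ge 3$ and let $\mathcal{H}(\mathcal{V},\mathcal{E})$ be the associating hypergraph on the Moufang loop $M(D_n,2)$. Then its matching number is $\upsilon(\mathcal{H})=n+\lfloor n/3\rfloor$.
   Context: Let $D_n=\langle x,y\mid x^n=y^2=1,\ xy=yx^{ -1}\rangle$ be the dihedral group of order $2n$. The Moufang loop $M(D_n,2)$ is the set $\{(g,\alpha): g\in D_n,\ \alpha\in\mathbb{Z}_2\}$ with the operation $(g_1,\alpha_1)\circ(g_2,\alpha_2)=\big(g_1^{1-\alpha_2}\, g_2^{(-1)^{\alpha_1}}\, g_1^{\alpha_2},\ \alpha_1+\alpha_2\big)$, where $\alpha_i\in\{0,1\}$ are used as integer exponents. The associating hypergraph $\mathcal{H}(\mathcal{V},\mathcal{E})$ has vertex set $\mathcal{V}=M(D_n,2)$, and its hyperedges are the triples of three pairwise distinct elements $a,b,c$, taken in an order $(a,b,c)$, such that $(a\circ b)\circ c=a\circ(b\circ c)$ (a 3-uniform directed hypergraph). A matching is a set of hyperedges no two of which share a vertex; the matching number $\upsilon(\mathcal{H})$ is the largest size of a matching. -}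

module Defs where

open import Data.Nat using (ℕ; NonZero; _∸_; _+_; _%_)
open import Data.Nat.DivMod using (m%n<n)
open import Data.Fin using (Fin; toℕ; fromℕ<)
open import Data.Bool using (Bool; true; false; not; _xor_)
open import Data.Product using (_×_; _,_)
open import Data.List using (List; _∷_; []; concatMap)
open import Data.List.Relation.Unary.All using (All)
open import Data.List.Relation.Unary.Unique.Propositional using (Unique)
open import Relation.Binary.PropositionalEquality using (_≡_; _≢_)

module _ (n : ℕ) .{{_ : NonZero n}} where

  _+ₙ_ : Fin n → Fin n → Fin n
  a +ₙ b = fromℕ< (m%n<n (toℕ a + toℕ b) n)

  -ₙ_ : Fin n → Fin n
  -ₙ a = fromℕ< (m%n<n (n ∸ toℕ a) n)

  zeroₙ : Fin n
  zeroₙ = fromℕ< (m%n<n 0 n)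

-- The dihedral group D_n of order 2n, in normal form:
-- (k , s) represents x^k y^s  (k ∈ ℤ_n, s ∈ {0,1}),
-- with x^n = y^2 = 1 and y x = x^{-1} y.
Dn : (n : ℕ) → Set
Dn n = Fin n × Bool

module _ {n : ℕ} .{{_ : NonZero n}} where

  -- x^a y^s · x^b y^t = x^(a + (-1)^s b) y^(s+t)
  _·D_ : Dn n → Dn n → Dn n
  (a , false) ·D (b , t) = (_+ₙ_ n a b , t)
  (a , true)  ·D (b , t) = (_+ₙ_ n a (-ₙ_ n b) , not t)

  eD : Dn n
  eD = (zeroₙ n , false)

  invD : Dn n → Dn n
  invD (a , false) = (-ₙ_ n a , false)
  invD (a , true)  = (a , true)

  powD : Dn n → Bool → Dn n
  powD g false = eD
  powD g true  = g

  sgnPowD : Dn n → Bool → Dn n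
  sgnPowD g false = g
  sgnPowD g true  = invD g

-- The Moufang loop M(D_n,2): pairs (g, α), α ∈ ℤ_2 (false = 0, true = 1).
M : (n : ℕ) → Set
M n = Dn n × Bool

module _ {n : ℕ} .{{_ : NonZero n}} where

  -- (g1,α1)∘(g2,α2) = (g1^(1-α2) g2^((-1)^α1) g1^α2 , α1+α2)
  _∘M_ : M n → M n → M n
  (g₁ , α₁) ∘M (g₂ , α₂) =
    ((powD g₁ (not α₂) ·D sgnPowD g₂ α₁) ·D powD g₁ α₂ , α₁ xor α₂)

  IsHyperedge : M n × M n × M n → Set
  IsHyperedge (a , b , c) =
    a ≢ b × b ≢ c × a ≢ c × ((a ∘M b) ∘M c ≡ a ∘M (b ∘M c))

  vertices : M n × M n × M n → List (M n)
  vertices (a , b , c) = a ∷ b ∷ c ∷ []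

  -- Given as a list whose hyperedges' vertices are all pairwise distinct
  -- (which also forces the listed hyperedges to be distinct).
  IsMatching : List (M n × M n × M n) → Set
  IsMatching es = All IsHyperedge es × Unique (concatMap vertices es)

-- M(D_n,2) has 4n elements and a matching covers three of them per hyperedge, so there are at
-- most ⌊4n/3⌋ = n + ⌊n/3⌋ hyperedges in it. Conversely, D_n × {0}, ⟨x⟩ × ℤ₂ and {(x^k y^s, s)}
-- are images of D_n under a homomorphism or an antihomomorphism, so any three distinct
-- elements of one of them form a hyperedge. List M(D_n,2) as the blocks (x^k, 1), (x^k, 0),
-- (x^k y, 0), (x^k y, 1), k ∈ ℤ_n. As the middle block of the first three has n ≥ 2 entries,
-- every three consecutive entries among the first 3n lie in ⟨x⟩ × ℤ₂ or in D_n × {0}; the last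
-- n entries lie in the third subgroup. Since 3n is a multiple of 3, cutting the list into
-- consecutive triples therefore yields ⌊4n/3⌋ disjoint hyperedges.
module Submission where

open import Defs
open import Algebra.Bundles using (AbelianGroup)
open import Algebra.Core using (Op₂)
import Algebra.Definitions
import Algebra.Morphism.Definitions
import Algebra.Properties.AbelianGroup as AbelianGroupProperties
import Algebra.Structures
open import Data.Bool using (Bool; true; false; not)
import Data.Bool.Properties as Bool
open import Data.Fin using (Fin; toℕ; fromℕ<)
import Data.Fin.Properties as Fin
open import Data.List using (List; []; _∷_; _++_; length; tabulate; take; filter; concatMap)
open import Data.List.Properties
  using (length-++; length-tabulate; length-filter; ++-assoc; ++-identityʳ)
open import Data.List.Membership.Propositional using (_∈_)
open import Data.List.Membership.Propositional.Properties
  using (∈-tabulate⁺; ∈-tabulate⁻; ∈-filter⁺; ∈-filter⁻; ∈-concat⁺′; ∈-map⁺)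
open import Data.List.Membership.Propositional.Properties.WithK using (unique∧set⇒bag)
open import Data.List.Relation.Binary.BagAndSetEquality using (∼bag⇒↭)
open import Data.List.Relation.Binary.Disjoint.Propositional using (Disjoint)
open import Data.List.Relation.Binary.Permutation.Propositional using (_↭_)
open import Data.List.Relation.Binary.Permutation.Propositional.Properties using (↭-length)
open import Data.List.Relation.Binary.Subset.Propositional using (_⊆_)
open import Data.List.Relation.Unary.All as All using (All; []; _∷_)
import Data.List.Relation.Unary.All.Properties as All
import Data.List.Relation.Unary.AllPairs as AllPairs
import Data.List.Relation.Unary.AllPairs.Properties as AllPairs
open import Data.List.Relation.Unary.Any using (here; there)
open import Data.List.Relation.Unary.Unique.Propositional using (Unique; []; _∷_)
import Data.List.Relation.Unary.Unique.Propositional.Properties as Unique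
open import Data.Nat using (ℕ; NonZero; zero; suc; _+_; _*_; _∸_; _%_; _/_; _≤_; s≤s; >-nonZero⁻¹)
open import Data.Nat.DivMod
  using (m%n<n; %-distribˡ-+; m%n%n≡m%n; m<n⇒m%n≡m; n%n≡0; m*n/n≡m; /-monoˡ-≤; +-distrib-/-∣ˡ)
open import Data.Nat.Divisibility using (∣-refl; divides)
open import Data.Nat.Properties
  using (+-comm; +-assoc; +-identityʳ; *-comm; m∸n+n≡m; <⇒≤; suc-injective; module ≤-Reasoning)
open import Data.Product using (_×_; _,_; Σ; ∃; proj₂; uncurry)
import Data.Product.Properties as Product
open import Data.Unit using (⊤; tt)
open import Function using (flip; _∘_; _⇔_; mk⇔)
open import Level using (0ℓ)
open import Relation.Binary.Definitions using (DecidableEquality)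
open import Relation.Binary.PropositionalEquality

Image : {A B : Set} → (A → B) → B → Set
Image φ y = ∃ λ x → φ x ≡ y

module _ {A B : Set} {_∙_ : Op₂ A} {_◦_ : Op₂ B} (φ : A → B) where
  open Algebra.Definitions {A = A} _≡_ using (Associative)
  open Algebra.Morphism.Definitions A B _≡_ using (Homomorphic₂)
  open ≡-Reasoning

  image-assoc : Associative _∙_ → Homomorphic₂ φ _∙_ _◦_ →
                ∀ {u v w} → Image φ u → Image φ v → Image φ w → (u ◦ v) ◦ w ≡ u ◦ (v ◦ w)
  image-assoc assoc homo (x , refl) (y , refl) (z , refl) = begin
    (φ x ◦ φ y) ◦ φ z ≡⟨ cong (_◦ φ z) (homo x y) ⟨
    φ (x ∙ y) ◦ φ z   ≡⟨ homo (x ∙ y) z ⟨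
    φ ((x ∙ y) ∙ z)   ≡⟨ cong φ (assoc x y z) ⟩
    φ (x ∙ (y ∙ z))   ≡⟨ homo x (y ∙ z) ⟩
    φ x ◦ φ (y ∙ z)   ≡⟨ cong (φ x ◦_) (homo y z) ⟩
    φ x ◦ (φ y ◦ φ z) ∎

module _ {A : Set} (_≟_ : DecidableEquality A) where
  open import Data.List.Membership.DecPropositional _≟_ using (_∈?_)
  open ≤-Reasoning

  unique-⊆⇒length≤ : ∀ {xs ys : List A} → Unique xs → Unique ys → xs ⊆ ys → length xs ≤ length ys
  unique-⊆⇒length≤ {xs} {ys} xs! ys! xs⊆ys = begin
    length xs                   ≡⟨ ↭-length xs↭ys∩xs ⟩
    length (filter (_∈? xs) ys) ≤⟨ length-filter (_∈? xs) ys ⟩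
    length ys                   ∎
    where
    xs≈ys∩xs : ∀ {x} → x ∈ xs ⇔ x ∈ filter (_∈? xs) ys
    xs≈ys∩xs = mk⇔ (λ x∈xs → ∈-filter⁺ (_∈? xs) (xs⊆ys x∈xs) x∈xs)
                   (proj₂ ∘ ∈-filter⁻ (_∈? xs) {xs = ys})

    xs↭ys∩xs : xs ↭ filter (_∈? xs) ys
    xs↭ys∩xs = ∼bag⇒↭ (unique∧set⇒bag xs! (Unique.filter⁺ (_∈? xs) ys!) xs≈ys∩xs)

module _ {A : Set} where

  chunks : List A → List (A × A × A)
  chunks (a ∷ b ∷ c ∷ xs) = (a , b , c) ∷ chunks xs
  chunks _                = []

  length-chunks : ∀ xs → length (chunks xs) ≡ length xs / 3
  length-chunks (a ∷ b ∷ c ∷ xs) =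
    trans (cong suc (length-chunks xs)) (sym (+-distrib-/-∣ˡ (length xs) (∣-refl {3})))
  length-chunks []           = refl
  length-chunks (_ ∷ [])     = refl
  length-chunks (_ ∷ _ ∷ []) = refl

  chunks-++ : ∀ k xs {ys} → length xs ≡ k * 3 → chunks (xs ++ ys) ≡ chunks xs ++ chunks ys
  chunks-++ zero    []               _  = refl
  chunks-++ (suc k) (a ∷ b ∷ c ∷ xs) eq =
    cong ((a , b , c) ∷_) (chunks-++ k xs (suc-injective (suc-injective (suc-injective eq))))

  Windows : (A × A × A → Set) → List A → Set
  Windows P (a ∷ b ∷ c ∷ xs) = P (a , b , c) × Windows P (b ∷ c ∷ xs)
  Windows P _                = ⊤

  module _ {P : A × A × A → Set} where

    windows-tail : ∀ x xs → Windows P (x ∷ xs) → Windows P xs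
    windows-tail x (_ ∷ _ ∷ _) (_ , w) = w
    windows-tail x []          _       = tt
    windows-tail x (_ ∷ [])    _       = tt

    windows⇒chunks : ∀ xs → Windows P xs → All P (chunks xs)
    windows⇒chunks (a ∷ b ∷ c ∷ xs) (p , w) =
      p ∷ windows⇒chunks xs (windows-tail c xs (windows-tail b (c ∷ xs) w))
    windows⇒chunks []           _ = []
    windows⇒chunks (_ ∷ [])     _ = []
    windows⇒chunks (_ ∷ _ ∷ []) _ = []

    all⇒windows : ∀ {Q : A → Set} → (∀ {a b c} → Q a → Q b → Q c → P (a , b , c)) →
                  ∀ {xs} → All Q xs → Windows P xs
    all⇒windows h (qa ∷ qb ∷ qc ∷ qs) = h qa qb qc , all⇒windows h (qb ∷ qc ∷ qs)
    all⇒windows h []                  = tt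
    all⇒windows h (_ ∷ [])            = tt
    all⇒windows h (_ ∷ _ ∷ [])        = tt

    windows-++ : ∀ xs {ys zs} → 2 ≤ length ys → Windows P (xs ++ ys) → Windows P (ys ++ zs) →
                 Windows P (xs ++ ys ++ zs)
    windows-++ []               _                 _           w = w
    windows-++ (_ ∷ [])         {_ ∷ _ ∷ _} _     (p , _)     w = p , w
    windows-++ (_ ∷ _ ∷ [])     {_ ∷ _ ∷ _} _     (p , q , _) w = p , q , w
    windows-++ (_ ∷ y ∷ z ∷ xs) 2≤ys              (p , w′)    w = p , windows-++ (y ∷ z ∷ xs) 2≤ys w′ w
    windows-++ (_ ∷ [])         {_ ∷ []} (s≤s ()) _           _
    windows-++ (_ ∷ _ ∷ [])     {_ ∷ []} (s≤s ()) _           _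

module _ (n : ℕ) .{{_ : NonZero n}} where
  open Algebra.Structures {A = Fin n} _≡_ using (IsAbelianGroup)
  open ≡-Reasoning

  private
    reduce : ℕ → Fin n
    reduce m = fromℕ< (m%n<n m n)

    toℕ-reduce : ∀ m → toℕ (reduce m) ≡ m % n
    toℕ-reduce m = Fin.toℕ-fromℕ< (m%n<n m n)

    reduce-cong : ∀ {m k} → m % n ≡ k % n → reduce m ≡ reduce k
    reduce-cong {m} {k} eq = Fin.toℕ-injective (begin
      toℕ (reduce m) ≡⟨ toℕ-reduce m ⟩
      m % n          ≡⟨ eq ⟩
      k % n          ≡⟨ toℕ-reduce k ⟨
      toℕ (reduce k) ∎)

    reduce-toℕ : ∀ a → reduce (toℕ a) ≡ a
    reduce-toℕ a = Fin.toℕ-injective (trans (toℕ-reduce (toℕ a)) (m<n⇒m%n≡m (Fin.toℕ<n a)))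

    %-absorbˡ : ∀ m k → (toℕ (reduce m) + k) % n ≡ (m + k) % n
    %-absorbˡ m k = begin
      (toℕ (reduce m) + k) % n ≡⟨ cong (λ x → (x + k) % n) (toℕ-reduce m) ⟩
      (m % n + k) % n          ≡⟨ %-distribˡ-+ (m % n) k n ⟩
      (m % n % n + k % n) % n  ≡⟨ cong (λ x → (x + k % n) % n) (m%n%n≡m%n m n) ⟩
      (m % n + k % n) % n      ≡⟨ %-distribˡ-+ m k n ⟨
      (m + k) % n              ∎

    %-absorbʳ : ∀ k m → (k + toℕ (reduce m)) % n ≡ (k + m) % n
    %-absorbʳ k m = begin
      (k + toℕ (reduce m)) % n ≡⟨ cong (_% n) (+-comm k _) ⟩
      (toℕ (reduce m) + k) % n ≡⟨ %-absorbˡ m k ⟩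
      (m + k) % n              ≡⟨ cong (_% n) (+-comm m k) ⟩
      (k + m) % n              ∎

    _⊕_ : Fin n → Fin n → Fin n
    _⊕_ = _+ₙ_ n

    ⊕-comm : ∀ a b → a ⊕ b ≡ b ⊕ a
    ⊕-comm a b = cong reduce (+-comm (toℕ a) (toℕ b))

    ⊕-assoc : ∀ a b c → (a ⊕ b) ⊕ c ≡ a ⊕ (b ⊕ c)
    ⊕-assoc a b c = reduce-cong (begin
      (toℕ (reduce (toℕ a + toℕ b)) + toℕ c) % n ≡⟨ %-absorbˡ (toℕ a + toℕ b) (toℕ c) ⟩
      (toℕ a + toℕ b + toℕ c) % n                ≡⟨ cong (_% n) (+-assoc (toℕ a) (toℕ b) (toℕ c)) ⟩
      (toℕ a + (toℕ b + toℕ c)) % n              ≡⟨ %-absorbʳ (toℕ a) (toℕ b + toℕ c) ⟨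
      (toℕ a + toℕ (reduce (toℕ b + toℕ c))) % n ∎)

    ⊕-identityˡ : ∀ a → zeroₙ n ⊕ a ≡ a
    ⊕-identityˡ a = trans (reduce-cong (%-absorbˡ 0 (toℕ a))) (reduce-toℕ a)

    ⊕-inverseˡ : ∀ a → (-ₙ_ n a) ⊕ a ≡ zeroₙ n
    ⊕-inverseˡ a = reduce-cong (begin
      (toℕ (reduce (n ∸ toℕ a)) + toℕ a) % n ≡⟨ %-absorbˡ (n ∸ toℕ a) (toℕ a) ⟩
      (n ∸ toℕ a + toℕ a) % n                ≡⟨ cong (_% n) (m∸n+n≡m (<⇒≤ (Fin.toℕ<n a))) ⟩
      n % n                                  ≡⟨ n%n≡0 n ⟩
      0                                      ≡⟨ m<n⇒m%n≡m (>-nonZero⁻¹ n) ⟨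
      0 % n                                  ∎)

  +ₙ-isAbelianGroup : IsAbelianGroup (_+ₙ_ n) (zeroₙ n) (-ₙ_ n)
  +ₙ-isAbelianGroup = record
    { isGroup = record
      { isMonoid = record
        { isSemigroup = record
          { isMagma = record { isEquivalence = isEquivalence ; ∙-cong = cong₂ _⊕_ }
          ; assoc   = ⊕-assoc
          }
        ; identity = ⊕-identityˡ , λ a → trans (⊕-comm a _) (⊕-identityˡ a)
        }
      ; inverse = ⊕-inverseˡ , λ a → trans (⊕-comm a _) (⊕-inverseˡ a)
      ; ⁻¹-cong = cong (-ₙ_ n)
      }
    ; comm = ⊕-comm
    }

ℤ/_ : (n : ℕ) .{{_ : NonZero n}} → AbelianGroup 0ℓ 0ℓ
ℤ/ n = record { isAbelianGroup = +ₙ-isAbelianGroup n }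

module _ {n : ℕ} .{{_ : NonZero n}} where
  open AbelianGroup (ℤ/ n) using (_∙_; ε; _⁻¹; assoc; comm; identityˡ; identityʳ)
  open AbelianGroupProperties (ℤ/ n) using (ε⁻¹≈ε; ⁻¹-involutive; ⁻¹-∙-comm)
  open Algebra.Definitions {A = Dn n} _≡_ using (Associative; RightIdentity)
  open Algebra.Morphism.Definitions (Dn n) (M n) _≡_ using (Homomorphic₂)
  open ≡-Reasoning

  ·D-identityʳ : RightIdentity eD _·D_
  ·D-identityʳ (a , false) = cong (_, false) (identityʳ a)
  ·D-identityʳ (a , true)  = cong (_, true) (trans (cong (a ∙_) ε⁻¹≈ε) (identityʳ a))

  ·D-assoc : Associative _·D_
  ·D-assoc (a , false) (b , false) (c , u) = cong (_, u) (assoc a b c)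
  ·D-assoc (a , false) (b , true)  (c , u) = cong (_, not u) (assoc a b (c ⁻¹))
  ·D-assoc (a , true)  (b , false) (c , u) = cong (_, not u) (begin
    a ∙ b ⁻¹ ∙ c ⁻¹   ≡⟨ assoc a (b ⁻¹) (c ⁻¹) ⟩
    a ∙ (b ⁻¹ ∙ c ⁻¹) ≡⟨ cong (a ∙_) (⁻¹-∙-comm b c) ⟩
    a ∙ (b ∙ c) ⁻¹    ∎)
  ·D-assoc (a , true)  (b , true)  (c , u) = cong₂ _,_ (begin
    a ∙ b ⁻¹ ∙ c         ≡⟨ assoc a (b ⁻¹) c ⟩
    a ∙ (b ⁻¹ ∙ c)       ≡⟨ cong (λ x → a ∙ (b ⁻¹ ∙ x)) (⁻¹-involutive c) ⟨
    a ∙ (b ⁻¹ ∙ c ⁻¹ ⁻¹) ≡⟨ cong (a ∙_) (⁻¹-∙-comm b (c ⁻¹)) ⟩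
    a ∙ (b ∙ c ⁻¹) ⁻¹    ∎) (sym (Bool.not-involutive u))

  ·D-assocᵒᵖ : Associative (flip _·D_)
  ·D-assocᵒᵖ g h k = sym (·D-assoc k h g)

  ι₀ ι₁ ι₂ : Dn n → M n
  ι₀ g       = (g , false)
  ι₁ (k , s) = ((k , false) , s)
  ι₂ (k , s) = ((k , s) , s)

  ι₀-homo : Homomorphic₂ ι₀ _·D_ _∘M_
  ι₀-homo g h = cong (_, false) (sym (·D-identityʳ (g ·D h)))

  ε∙b∙a≡a∙b : ∀ a b → ε ∙ b ∙ a ≡ a ∙ b
  ε∙b∙a≡a∙b a b = trans (cong (_∙ a) (identityˡ b)) (comm b a)

  ι₁-homo : Homomorphic₂ ι₁ _·D_ _∘M_
  ι₁-homo (a , false) (b , false) = cong (λ k → ((k , false) , false)) (sym (identityʳ (a ∙ b)))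
  ι₁-homo (a , false) (b , true)  = cong (λ k → ((k , false) , true))  (sym (ε∙b∙a≡a∙b a b))
  ι₁-homo (a , true)  (b , false) = cong (λ k → ((k , false) , true))  (sym (identityʳ (a ∙ b ⁻¹)))
  ι₁-homo (a , true)  (b , true)  = cong (λ k → ((k , false) , false)) (sym (ε∙b∙a≡a∙b a (b ⁻¹)))

  ι₂-antihomo : Homomorphic₂ ι₂ (flip _·D_) _∘M_
  ι₂-antihomo (a , false) (b , false) =
    cong (λ k → ((k , false) , false)) (trans (comm b a) (sym (identityʳ (a ∙ b))))
  ι₂-antihomo (a , false) (b , true)  =
    cong (λ k → ((k , true) , true)) (cong (_∙ a ⁻¹) (sym (identityˡ b)))
  ι₂-antihomo (a , true)  (b , false) = cong (λ k → ((k , true) , true)) (begin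
    b ∙ a              ≡⟨ comm b a ⟩
    a ∙ b              ≡⟨ cong (a ∙_) (⁻¹-involutive b) ⟨
    a ∙ b ⁻¹ ⁻¹        ≡⟨ identityʳ (a ∙ b ⁻¹ ⁻¹) ⟨
    a ∙ b ⁻¹ ⁻¹ ∙ ε    ≡⟨ cong (a ∙ b ⁻¹ ⁻¹ ∙_) ε⁻¹≈ε ⟨
    a ∙ b ⁻¹ ⁻¹ ∙ ε ⁻¹ ∎)
  ι₂-antihomo (a , true)  (b , true)  =
    cong (λ k → ((k , false) , false)) (cong (_∙ a ⁻¹) (sym (identityˡ b)))

module _ {n : ℕ} .{{_ : NonZero n}} where
  open Algebra.Definitions {A = Dn n} _≡_ using (Associative)
  open Algebra.Morphism.Definitions (Dn n) (M n) _≡_ using (Homomorphic₂)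

  Associates : M n × M n × M n → Set
  Associates (a , b , c) = (a ∘M b) ∘M c ≡ a ∘M (b ∘M c)

  image-windows : ∀ {_∙_ : Op₂ (Dn n)} (φ : Dn n → M n) →
                  Associative _∙_ → Homomorphic₂ φ _∙_ _∘M_ →
                  ∀ {xs} → All (Image φ) xs → Windows Associates xs
  image-windows φ assoc homo = all⇒windows (image-assoc {_◦_ = _∘M_} φ assoc homo)

  chunks-hyperedges : ∀ xs → Unique xs → All Associates (chunks xs) → All IsHyperedge (chunks xs)
  chunks-hyperedges (a ∷ b ∷ c ∷ xs) ((a≢b ∷ a≢c ∷ _) ∷ (b≢c ∷ _) ∷ _ ∷ xs!) (abc ∷ abcs) =
    (a≢b , b≢c , a≢c , abc) ∷ chunks-hyperedges xs xs! abcs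
  chunks-hyperedges []           _ _ = []
  chunks-hyperedges (_ ∷ [])     _ _ = []
  chunks-hyperedges (_ ∷ _ ∷ []) _ _ = []

  vertices-chunks : ∀ xs → concatMap vertices (chunks xs) ≡ take (length (chunks xs) * 3) xs
  vertices-chunks (a ∷ b ∷ c ∷ xs) = cong (λ ys → a ∷ b ∷ c ∷ ys) (vertices-chunks xs)
  vertices-chunks []               = refl
  vertices-chunks (_ ∷ [])         = refl
  vertices-chunks (_ ∷ _ ∷ [])     = refl

  chunks-isMatching : ∀ {xs} → Unique xs → All Associates (chunks xs) → IsMatching (chunks xs)
  chunks-isMatching {xs} xs! abcs =
    chunks-hyperedges xs xs! abcs , subst Unique (sym (vertices-chunks xs)) (Unique.take⁺ _ xs!)

  length-vertices : ∀ es → length (concatMap vertices es) ≡ length es * 3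
  length-vertices []       = refl
  length-vertices (_ ∷ es) = cong (λ m → suc (suc (suc m))) (length-vertices es)

  layer : Bool → Bool → List (M n)
  layer s α = tabulate (λ k → ((k , s) , α))

  length-layer : ∀ s α → length (layer s α) ≡ n
  length-layer s α = length-tabulate _

  layer-unique : ∀ s α → Unique (layer s α)
  layer-unique s α = Unique.tabulate⁺ λ { refl → refl }

  layers-disjoint : ∀ {s α t β} → (s , α) ≢ (t , β) → Disjoint (layer s α) (layer t β)
  layers-disjoint s,α≢t,β (x∈ , x∈′) with ∈-tabulate⁻ x∈ | ∈-tabulate⁻ x∈′
  ... | _ , refl | _ , refl = s,α≢t,β refl

  rotations₁ rotations₀ reflections₀ reflections₁ : List (M n)
  rotations₁   = layer false true
  rotations₀   = layer false false
  reflections₀ = layer true false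
  reflections₁ = layer true true

  labels : List (Bool × Bool)
  labels = (false , true) ∷ (false , false) ∷ (true , false) ∷ (true , true) ∷ []

  labels-unique : Unique labels
  labels-unique = ((λ ()) ∷ (λ ()) ∷ (λ ()) ∷ []) ∷ ((λ ()) ∷ (λ ()) ∷ []) ∷ ((λ ()) ∷ []) ∷ [] ∷ []

  ∈-labels : ∀ s α → (s , α) ∈ labels
  ∈-labels false true  = here refl
  ∈-labels false false = there (here refl)
  ∈-labels true  false = there (there (here refl))
  ∈-labels true  true  = there (there (there (here refl)))

  enum : List (M n)
  enum = concatMap (uncurry layer) labels

  enum-unique : Unique enum
  enum-unique = Unique.concat⁺
    (All.map⁺ (All.universal (uncurry layer-unique) labels))
    (AllPairs.map⁺ (AllPairs.map layers-disjoint labels-unique))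

  ∈-enum : ∀ x → x ∈ enum
  ∈-enum ((k , s) , α) = ∈-concat⁺′ (∈-tabulate⁺ k) (∈-map⁺ (uncurry layer) (∈-labels s α))

  isMatching⇒length≤ : ∀ {es} → IsMatching es → length es ≤ length enum / 3
  isMatching⇒length≤ {es} (_ , vertices!) = begin
    length es                          ≡⟨ m*n/n≡m (length es) 3 ⟨
    length es * 3 / 3                  ≡⟨ cong (_/ 3) (length-vertices es) ⟨
    length (concatMap vertices es) / 3 ≤⟨ /-monoˡ-≤ 3 vertices≤enum ⟩
    length enum / 3                    ∎
    where
    open ≤-Reasoning

    _≟_ : DecidableEquality (M n)
    _≟_ = Product.≡-dec (Product.≡-dec Fin._≟_ Bool._≟_) Bool._≟_

    vertices≤enum : length (concatMap vertices es) ≤ length enum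
    vertices≤enum = unique-⊆⇒length≤ _≟_ vertices! enum-unique (λ _ → ∈-enum _)

  front : List (M n)
  front = rotations₁ ++ rotations₀ ++ reflections₀

  enum-blocks : enum ≡ front ++ reflections₁
  enum-blocks = begin
    rotations₁ ++ rotations₀ ++ reflections₀ ++ reflections₁ ++ []
      ≡⟨ cong (λ ys → rotations₁ ++ rotations₀ ++ reflections₀ ++ ys) (++-identityʳ reflections₁) ⟩
    rotations₁ ++ rotations₀ ++ reflections₀ ++ reflections₁
      ≡⟨ cong (rotations₁ ++_) (++-assoc rotations₀ reflections₀ reflections₁) ⟨
    rotations₁ ++ (rotations₀ ++ reflections₀) ++ reflections₁
      ≡⟨ ++-assoc rotations₁ (rotations₀ ++ reflections₀) reflections₁ ⟨
    front ++ reflections₁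
      ∎
    where open ≡-Reasoning

  length-front : length front ≡ n * 3
  length-front = begin
    length front
      ≡⟨ length-++ rotations₁ ⟩
    length rotations₁ + length (rotations₀ ++ reflections₀)
      ≡⟨ cong (length rotations₁ +_) (length-++ rotations₀) ⟩
    length rotations₁ + (length rotations₀ + length reflections₀)
      ≡⟨ cong₂ _+_ (length-layer _ _) (cong₂ _+_ (length-layer _ _) (length-layer _ _)) ⟩
    n + (n + n)
      ≡⟨ cong (λ m → n + (n + m)) (+-identityʳ n) ⟨
    3 * n
      ≡⟨ *-comm 3 n ⟩
    n * 3
      ∎
    where open ≡-Reasoning

  length-enum : length enum ≡ n * 3 + n
  length-enum = begin
    length enum                         ≡⟨ cong length enum-blocks ⟩
    length (front ++ reflections₁)      ≡⟨ length-++ front ⟩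
    length front + length reflections₁  ≡⟨ cong₂ _+_ length-front (length-layer _ _) ⟩
    n * 3 + n                           ∎
    where open ≡-Reasoning

  length-enum/3 : length enum / 3 ≡ n + n / 3
  length-enum/3 = begin
    length enum / 3   ≡⟨ cong (_/ 3) length-enum ⟩
    (n * 3 + n) / 3   ≡⟨ +-distrib-/-∣ˡ n (divides n refl) ⟩
    n * 3 / 3 + n / 3 ≡⟨ cong (_+ n / 3) (m*n/n≡m n 3) ⟩
    n + n / 3         ∎
    where open ≡-Reasoning

  enum-chunks-associate : 2 ≤ n → All Associates (chunks enum)
  enum-chunks-associate 2≤n = subst (All Associates ∘ chunks) (sym enum-blocks)
    (subst (All Associates) (sym (chunks-++ n front length-front))
      (All.++⁺ (windows⇒chunks front front-windows)
               (windows⇒chunks reflections₁ reflections₁-windows)))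
    where
    front-windows : Windows Associates front
    front-windows = windows-++ rotations₁ (subst (2 ≤_) (sym (length-layer _ _)) 2≤n)
      (image-windows ι₁ ·D-assoc ι₁-homo
        (All.++⁺ (All.tabulate⁺ λ k → (k , true) , refl) (All.tabulate⁺ λ k → (k , false) , refl)))
      (image-windows ι₀ ·D-assoc ι₀-homo
        (All.++⁺ (All.tabulate⁺ λ k → (k , false) , refl) (All.tabulate⁺ λ k → (k , true) , refl)))

    reflections₁-windows : Windows Associates reflections₁
    reflections₁-windows = image-windows ι₂ ·D-assocᵒᵖ ι₂-antihomo
      (All.tabulate⁺ λ k → (k , true) , refl)

theorem4p10 : (n : ℕ) → .{{_ : NonZero n}} → 3 ≤ n →
    Σ (List (M n × M n × M n)) (λ es → IsMatching es × length es ≡ n + n / 3)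
      × ((es : List (M n × M n × M n)) → IsMatching es → length es ≤ n + n / 3)
theorem4p10 n 3≤n =
  ( chunks enum
  , chunks-isMatching enum-unique (enum-chunks-associate (<⇒≤ 3≤n))
  , trans (length-chunks enum) length-enum/3
  )
  , λ es es-matching → subst (length es ≤_) length-enum/3 (isMatching⇒length≤ es-matching)
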